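{- Let $\mathrm{isort}$ be the insertion sort defined, for every type $T$ and every $\leq : T \to T \to \mathrm{bool}$, by $\mathrm{isort}_\leq\,[] = []$ and $\mathrm{isort}_\leq\,(x :: xs) = [x] \mathbin{\land\hspace{ -.45em}\land}_\leq \mathrm{isort}_\leq\,xs$. Then $\mathrm{isort}$ satisfies the characteristic property.
   Context: Lists: $[]$ is the empty list, $x :: s$ is cons, $[x]$ is the singleton list, $\mathbin{+\!\!+}$ is concatenation. A "relation" $\leq$ on a type $T$ is a function $T \to T \to \mathrm{bool}$. The merge of two lists w.r.t. $\leq$ is defined by $[] \mathbin{\land\hspace{ -.45em}\land}_\leq ys = ys$, $xs \mathbin{\land\hspace{ -.45em}\land}_\leq [] = xs$, and $(x :: xs) \mathbin{\land\hspace{ -.45em}\land}_\leq (y :: ys) = x :: (xs \mathbin{\land\hspace{ -.45em}\land}_\leq (y :: ys))$ if $x \leq y$, and $= y :: ((x :: xs) \mathbin{\land\hspace{ -.45em}\land}_\leq ys)$ otherwise. A sort function $\mathrm{sort}$ assigns to every type $T$ and relation $\leq$ on $T$ a function $\mathrm{sort}_\leq : \mathrm{list}\,T \to \mathrm{list}\,T$. It satisfies the characteristic property if there is a polymorphic function $\mathrm{asort}$ of type $\forall (T\,R : \mathcal{U}), (R \to R \to R) \to (T \to R) \to R \to \mathrm{list}\,T \to R$ (arguments: merge, singleton, empty, input) such that: (1) for all $T$, $\leq$, $xs$: $\mathrm{asort}\,(\mathbin{\land\hspace{ -.45em}\land}_\leq)\,(\lambda x.[x])\,[]\,xs = \mathrm{sort}_\leq\,xs$;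 (2) for all $T$, $xs$: $\mathrm{asort}\,(\mathbin{+\!\!+})\,(\lambda x.[x])\,[]\,xs = xs$; (3) $\mathrm{asort}$ is relationally parametric: for all types $T_1,T_2$ and relation $\sim_T \subseteq T_1 \times T_2$, all types $R_1,R_2$ and relation $\sim_R \subseteq R_1\times R_2$, all $m_i : R_i \to R_i \to R_i$ with $a_1 \sim_R a_2 \wedge b_1 \sim_R b_2 \Rightarrow m_1\,a_1\,b_1 \sim_R m_2\,a_2\,b_2$, all $s_i : T_i \to R_i$ with $x_1 \sim_T x_2 \Rightarrow s_1\,x_1 \sim_R s_2\,x_2$, all $e_i : R_i$ with $e_1 \sim_R e_2$, and all lists $xs_1 : \mathrm{list}\,T_1$, $xs_2 : \mathrm{list}\,T_2$ of equal length that are pointwise $\sim_T$-related, we have $\mathrm{asort}\,m_1\,s_1\,e_1\,xs_1 \sim_R \mathrm{asort}\,m_2\,s_2\,e_2\,xs_2$. -}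

module Defs where

open import Data.Bool using (Bool; true; false; if_then_else_)
open import Data.List using (List; []; _∷_; [_]; _++_)
open import Data.List.Relation.Binary.Pointwise using (Pointwise)
open import Data.Product using (Σ; _×_)
open import Relation.Binary.PropositionalEquality using (_≡_)

Rel𝔹 : Set → Set
Rel𝔹 T = T → T → Bool

-- merge of two lists w.r.t. ≤ (defined as in the paper; the inner
-- recursion on the second list is done by an auxiliary function so that
-- Agda sees structural recursion).
merge : {T : Set} → Rel𝔹 T → List T → List T → List T
merge {T} leq [] ys = ys
merge {T} leq (x ∷ xs) ys = go ys
  where
  go : List T → List T
  go [] = x ∷ xs
  go (y ∷ ys') = if leq x y then x ∷ merge leq xs (y ∷ ys') else y ∷ go ys'

SortFn : Set₁
SortFn = {T : Set} → Rel𝔹 T → List T → List T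

-- Type of the abstract sort: merge, singleton, empty, input.
ASort : Set₁
ASort = (T R : Set) → (R → R → R) → (T → R) → R → List T → R

Parametric : ASort → Set₁
Parametric asort =
  (T₁ T₂ : Set) (_~T_ : T₁ → T₂ → Set)
  (R₁ R₂ : Set) (_~R_ : R₁ → R₂ → Set)
  (m₁ : R₁ → R₁ → R₁) (m₂ : R₂ → R₂ → R₂) →
  (∀ {a₁ a₂ b₁ b₂} → a₁ ~R a₂ → b₁ ~R b₂ → m₁ a₁ b₁ ~R m₂ a₂ b₂) →
  (s₁ : T₁ → R₁) (s₂ : T₂ → R₂) →
  (∀ {x₁ x₂} → x₁ ~T x₂ → s₁ x₁ ~R s₂ x₂) →
  (e₁ : R₁) (e₂ : R₂) → e₁ ~R e₂ →
  (xs₁ : List T₁) (xs₂ : List T₂) → Pointwise _~T_ xs₁ xs₂ →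
  asort T₁ R₁ m₁ s₁ e₁ xs₁ ~R asort T₂ R₂ m₂ s₂ e₂ xs₂

CharacteristicProperty : SortFn → Set₁
CharacteristicProperty sort =
  Σ ASort λ asort →
    ((T : Set) (leq : Rel𝔹 T) (xs : List T) →
       asort T (List T) (merge leq) [_] [] xs ≡ sort leq xs)
  × ((T : Set) (xs : List T) →
       asort T (List T) _++_ [_] [] xs ≡ xs)
  × Parametric asort

isort : SortFn
isort leq [] = []
isort leq (x ∷ xs) = merge leq [ x ] (isort leq xs)

-- Insertion sort is the right fold of merge over singletons, so the abstract
-- sort is that fold with merge, singleton and empty as parameters.  With
-- concatenation in place of merge it rebuilds its input, and it is
-- parametric because a fold only applies the given operations to related
-- arguments.
module Submission where

open import Defs
open import Data.List using (List; []; _∷_; [_]; _++_; foldr)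
open import Data.List.Properties using (foldr-universal; id-is-foldr)
open import Data.List.Relation.Binary.Pointwise using (Pointwise; []; _∷_)
open import Data.Product using (_,_)
open import Relation.Binary.PropositionalEquality using (_≡_; refl; sym)

-- _~B_, f₁ and f₂ are explicit because Agda cannot infer them through foldr.
foldr-preserves-Pointwise :
  {A₁ A₂ B₁ B₂ : Set} {_~A_ : A₁ → A₂ → Set} (_~B_ : B₁ → B₂ → Set)
  (f₁ : A₁ → B₁ → B₁) (f₂ : A₂ → B₂ → B₂) →
  (∀ {x₁ x₂ y₁ y₂} → x₁ ~A x₂ → y₁ ~B y₂ → f₁ x₁ y₁ ~B f₂ x₂ y₂) →
  {e₁ : B₁} {e₂ : B₂} → e₁ ~B e₂ →
  {xs₁ : List A₁} {xs₂ : List A₂} → Pointwise _~A_ xs₁ xs₂ →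
  foldr f₁ e₁ xs₁ ~B foldr f₂ e₂ xs₂
foldr-preserves-Pointwise _~B_ f₁ f₂ f-rel e-rel []               = e-rel
foldr-preserves-Pointwise _~B_ f₁ f₂ f-rel e-rel (x-rel ∷ xs-rel) =
  f-rel x-rel (foldr-preserves-Pointwise _~B_ f₁ f₂ f-rel e-rel xs-rel)

asort-foldr : ASort
asort-foldr T R m s e = foldr (λ x r → m (s x) r) e

asort-foldr-merge≡isort : (T : Set) (leq : Rel𝔹 T) (xs : List T) →
                          asort-foldr T (List T) (merge leq) [_] [] xs ≡ isort leq xs
asort-foldr-merge≡isort T leq xs =
  sym (foldr-universal (isort leq) _ [] refl (λ _ _ → refl) xs)

asort-foldr-++≡id : (T : Set) (xs : List T) → asort-foldr T (List T) _++_ [_] [] xs ≡ xs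
asort-foldr-++≡id T xs = sym (id-is-foldr xs)

asort-foldr-parametric : Parametric asort-foldr
asort-foldr-parametric _ _ _ _ _ _~R_ m₁ m₂ m-rel s₁ s₂ s-rel _ _ e-rel _ _ =
  foldr-preserves-Pointwise _~R_ (λ x → m₁ (s₁ x)) (λ x → m₂ (s₂ x))
    (λ x-rel r-rel → m-rel (s-rel x-rel) r-rel) e-rel

lemma3p2 : CharacteristicProperty isort
lemma3p2 = asort-foldr , asort-foldr-merge≡isort , asort-foldr-++≡id , asort-foldr-parametric
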